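{- Let $(F_n)_{n\in\mathbb{N}}$ be an $\mathbb{N}$-indexed family of pointed finite linearly ordered types. Then $\prod_{n\in\mathbb{N}}F_n$ with the discrete-sequence closeness function is a totally bounded closeness space.
   Context: Constructive type theory with function extensionality. A type is finite linearly ordered if equipped with an equivalence to $\{0,\dots,m-1\}$ for some $m$ (such types have decidable equality); pointed means an element is given. For $\alpha,\beta\in\prod_nF_n$, $\alpha\sim^n\beta$ means $\alpha_i=\beta_i$ for all $i<n$. $\mathbb{N}_\infty$: decreasing binary sequences; $\underline{n}$: $n$ ones then zeros; $u\preceq v$ iff $\forall n\,(u_n=1\Rightarrow v_n=1)$. The discrete-sequence closeness function is $c(\alpha,\beta)_n=1$ if $\alpha\sim^{n+1}\beta$ and $0$ otherwise; $C_\varepsilon(\alpha,\beta)$ means $\underline{\varepsilon}\preceq c(\alpha,\beta)$. An $\varepsilon$-net of a closeness space $X$ is a finite linearly ordered $X'$ with $g:X'\to X$, $h:X\to X'$ and $C_\varepsilon(x,g(h(x)))$ for all $x$; $X$ is totally bounded if it has an $\varepsilon$-net for every $\varepsilon\in\mathbb{N}$. -}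

module Defs where

open import Data.Nat using (ℕ; zero; suc; _<_)
open import Data.Bool using (Bool; true; false; _∧_)
open import Data.Fin using (Fin)
open import Data.Product using (Σ; _×_; _,_)
open import Function.Bundles using (_↔_; Inverse)
open import Data.Fin using () renaming (_≟_ to _≟F_)
open import Relation.Binary.PropositionalEquality using (sym; cong; module ≡-Reasoning)
open import Relation.Binary.PropositionalEquality using (_≡_)
open import Relation.Nullary using (Dec; yes; no)
open import Relation.Nullary.Decidable using (⌊_⌋)

-- Binary sequences, with 1 = true, 0 = false.
-- ℕ∞ : decreasing binary sequences.
decreasing : (ℕ → Bool) → Set
decreasing u = ∀ n → u (suc n) ≡ true → u n ≡ true

ℕ∞ : Set
ℕ∞ = Σ (ℕ → Bool) decreasing

seq : ℕ∞ → ℕ → Bool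
seq (u , _) = u

-- equality of elements of ℕ∞ (pointwise; function extensionality is assumed
-- in the paper, so this is the paper's equality)
_≈∞_ : ℕ∞ → ℕ∞ → Set
u ≈∞ v = ∀ n → seq u n ≡ seq v n

_≼_ : ℕ∞ → ℕ∞ → Set
u ≼ v = ∀ n → seq u n ≡ true → seq v n ≡ true

∞ : ℕ∞
∞ = (λ _ → true) , (λ _ _ → _≡_.refl)

min∞ : ℕ∞ → ℕ∞ → ℕ∞
min∞ (u , du) (v , dv) = (λ n → u n ∧ v n) , d
  where
  d : ∀ n → (u (suc n) ∧ v (suc n)) ≡ true → (u n ∧ v n) ≡ true
  d n p with u (suc n) | v (suc n) | du n | dv n
  d n p | true | true | a | b rewrite a _≡_.refl | b _≡_.refl = _≡_.refl

ltb : ℕ → ℕ → Bool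
ltb i zero = false
ltb zero (suc n) = true
ltb (suc i) (suc n) = ltb i n

under : ℕ → ℕ∞
under n = (λ i → ltb i n) , d n
  where
  d : ∀ n i → ltb (suc i) n ≡ true → ltb i n ≡ true
  d zero i ()
  d (suc n) zero p = _≡_.refl
  d (suc n) (suc i) p = d n i p

-- Equality on X is given as a parameter relation
-- (pointwise equality for sequence types, by function extensionality).
record IsClosenessSpace {X : Set} (_≋_ : X → X → Set) (c : X → X → ℕ∞) : Set where
  field
    c-eq→∞ : ∀ x y → c x y ≈∞ ∞ → x ≋ y
    c-refl∞ : ∀ x → c x x ≈∞ ∞
    c-sym : ∀ x y → c x y ≈∞ c y x
    c-ultra : ∀ x y z → min∞ (c x y) (c y z) ≼ c x z

C : {X : Set} → (X → X → ℕ∞) → ℕ → X → X → Set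
C c ε x y = under ε ≼ c x y

FinLinOrder : Set → Set
FinLinOrder F = Σ ℕ (λ m → F ↔ Fin m)

record Net {X : Set} (c : X → X → ℕ∞) (ε : ℕ) : Set₁ where
  field
    X' : Set
    X'-fin : FinLinOrder X'
    g : X' → X
    h : X → X'
    approx : ∀ x → C c ε x (g (h x))

TotallyBounded : {X : Set} → (X → X → ℕ∞) → Set₁
TotallyBounded c = ∀ ε → Net c ε

_∼[_]_ : {F : ℕ → Set} → ((n : ℕ) → F n) → ℕ → ((n : ℕ) → F n) → Set
α ∼[ n ] β = ∀ i → i < n → α i ≡ β i

agreeUpTo : {F : ℕ → Set} → (∀ n (a b : F n) → Dec (a ≡ b)) →
            ((n : ℕ) → F n) → ((n : ℕ) → F n) → ℕ → Bool
agreeUpTo d α β zero = true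
agreeUpTo d α β (suc k) = agreeUpTo d α β k ∧ ⌊ d k (α k) (β k) ⌋

-- c(α,β)_n = 1 iff α ∼^{n+1} β
discSeqC : {F : ℕ → Set} → (∀ n (a b : F n) → Dec (a ≡ b)) →
           ((n : ℕ) → F n) → ((n : ℕ) → F n) → ℕ∞
discSeqC d α β = (λ n → agreeUpTo d α β (suc n)) , dec
  where
  dec : ∀ n → (agreeUpTo d α β (suc n) ∧ ⌊ d (suc n) (α (suc n)) (β (suc n)) ⌋) ≡ true
            → agreeUpTo d α β (suc n) ≡ true
  dec n p with agreeUpTo d α β (suc n)
  dec n p | true = _≡_.refl
  dec n () | false

finDecEq : {F : Set} → FinLinOrder F → (a b : F) → Dec (a ≡ b)
finDecEq {F} (m , e) a b with Inverse.to e a ≟F Inverse.to e b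
... | yes p = yes (begin
        a                         ≡⟨ sym (Inverse.strictlyInverseʳ e a) ⟩
        Inverse.from e (Inverse.to e a) ≡⟨ cong (Inverse.from e) p ⟩
        Inverse.from e (Inverse.to e b) ≡⟨ Inverse.strictlyInverseʳ e b ⟩
        b ∎)
  where open ≡-Reasoning
... | no np = no (λ q → np (cong (Inverse.to e) q))

_≐_ : {F : ℕ → Set} → ((n : ℕ) → F n) → ((n : ℕ) → F n) → Set
α ≐ β = ∀ n → α n ≡ β n

-- The closeness c(α,β) records exactly how long a prefix α and β share, so the
-- closeness axioms reduce to reflexivity, symmetry and transitivity of ∼ⁿ.
-- For total boundedness, an ε-net is the finite type of length-ε prefixes:
-- truncate a sequence to its prefix, and extend a prefix back to a sequence
-- by the given points; the round trip agrees with the original below ε.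

module Submission where

open import Defs
open import Data.Nat using (ℕ; zero; suc; _<_; _≤_; z≤n; s≤s; _*_)
open import Data.Nat.Properties using (≤-trans; ≤-refl; n≤1+n; m<1+n⇒m<n∨m≡n)
open import Data.Product using (_×_; _,_)
open import Data.Product.Algebra using (×-cong)
open import Data.Bool using (true; false; _∧_)
open import Data.Unit using (⊤; tt)
open import Data.Empty using (⊥-elim)
open import Data.Sum using (inj₁; inj₂)
open import Data.Fin.Properties using (1↔⊤; *↔×)
open import Function.Properties.Inverse using (↔-sym; ↔-trans)
open import Relation.Binary.PropositionalEquality using (_≡_; refl; sym; trans)
open import Relation.Nullary using (Dec; yes; no)
open import Relation.Nullary.Decidable using (⌊_⌋)

∧≡true⇒ : ∀ {a b} → a ∧ b ≡ true → a ≡ true × b ≡ true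
∧≡true⇒ {true} b≡true = refl , b≡true

∧-≡true : ∀ {a b} → a ≡ true → b ≡ true → a ∧ b ≡ true
∧-≡true refl refl = refl

≡true-ext : ∀ {a b} → (a ≡ true → b ≡ true) → (b ≡ true → a ≡ true) → a ≡ b
≡true-ext {false} {false} _ _ = refl
≡true-ext {false} {true}  _ b⇒a = b⇒a refl
≡true-ext {true}  {false} a⇒b _ = sym (a⇒b refl)
≡true-ext {true}  {true}  _ _ = refl

⌊⌋≡true⇒ : ∀ {A : Set} (a? : Dec A) → ⌊ a? ⌋ ≡ true → A
⌊⌋≡true⇒ (yes a) _ = a

⌊⌋≡true⇐ : ∀ {A : Set} (a? : Dec A) → A → ⌊ a? ⌋ ≡ true
⌊⌋≡true⇐ (yes _) _ = refl
⌊⌋≡true⇐ (no ¬a) a = ⊥-elim (¬a a)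

ltb⇒< : ∀ i n → ltb i n ≡ true → i < n
ltb⇒< zero    (suc n) _ = s≤s z≤n
ltb⇒< (suc i) (suc n) p = s≤s (ltb⇒< i n p)

module _ {F : ℕ → Set} where

  ∼-sym : ∀ {α β : (n : ℕ) → F n} {k} → α ∼[ k ] β → β ∼[ k ] α
  ∼-sym α∼β i i<k = sym (α∼β i i<k)

  ∼-trans : ∀ {α β γ : (n : ℕ) → F n} {k} → α ∼[ k ] β → β ∼[ k ] γ → α ∼[ k ] γ
  ∼-trans α∼β β∼γ i i<k = trans (α∼β i i<k) (β∼γ i i<k)

  ∼-mono : ∀ {α β : (n : ℕ) → F n} {m n} → m ≤ n → α ∼[ n ] β → α ∼[ m ] β
  ∼-mono m≤n α∼β i i<m = α∼β i (≤-trans i<m m≤n)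

  ∼-suc : ∀ {α β : (n : ℕ) → F n} {k} → α ∼[ k ] β → α k ≡ β k → α ∼[ suc k ] β
  ∼-suc α∼β αk≡βk i i<1+k with m<1+n⇒m<n∨m≡n i<1+k
  ... | inj₁ i<k  = α∼β i i<k
  ... | inj₂ refl = αk≡βk

module _ {F : ℕ → Set} (d : ∀ n (a b : F n) → Dec (a ≡ b)) where

  agreeUpTo⇒∼ : ∀ α β k → agreeUpTo d α β k ≡ true → α ∼[ k ] β
  agreeUpTo⇒∼ α β (suc k) agree with ∧≡true⇒ {agreeUpTo d α β k} agree
  ... | agree-k , αk≡ᵇβk =
    ∼-suc (agreeUpTo⇒∼ α β k agree-k) (⌊⌋≡true⇒ (d k (α k) (β k)) αk≡ᵇβk)

  ∼⇒agreeUpTo : ∀ α β k → α ∼[ k ] β → agreeUpTo d α β k ≡ true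
  ∼⇒agreeUpTo α β zero    _   = refl
  ∼⇒agreeUpTo α β (suc k) α∼β =
    ∧-≡true (∼⇒agreeUpTo α β k (∼-mono (n≤1+n k) α∼β))
            (⌊⌋≡true⇐ (d k (α k) (β k)) (α∼β k ≤-refl))

  discSeqC-isClosenessSpace : IsClosenessSpace (_≐_ {F}) (discSeqC d)
  discSeqC-isClosenessSpace = record
    { c-eq→∞  = λ α β c≈∞ n → agreeUpTo⇒∼ α β (suc n) (c≈∞ n) n ≤-refl
    ; c-refl∞ = λ α n → ∼⇒agreeUpTo α α (suc n) (λ _ _ → refl)
    ; c-sym   = λ α β n → ≡true-ext
        (λ p → ∼⇒agreeUpTo β α (suc n) (∼-sym (agreeUpTo⇒∼ α β (suc n) p)))
        (λ p → ∼⇒agreeUpTo α β (suc n) (∼-sym (agreeUpTo⇒∼ β α (suc n) p)))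
    ; c-ultra = λ α β γ n p → let (αβ , βγ) = ∧≡true⇒ {agreeUpTo d α β (suc n)} p in
        ∼⇒agreeUpTo α γ (suc n)
          (∼-trans (agreeUpTo⇒∼ α β (suc n) αβ) (agreeUpTo⇒∼ β γ (suc n) βγ))
    }

  ∼⇒C : ∀ {α β} ε → α ∼[ ε ] β → C (discSeqC d) ε α β
  ∼⇒C {α} {β} ε α∼β n εₙ = ∼⇒agreeUpTo α β (suc n) (∼-mono (ltb⇒< n ε εₙ) α∼β)

FinLinOrder-⊤ : FinLinOrder ⊤
FinLinOrder-⊤ = 1 , ↔-sym 1↔⊤

FinLinOrder-× : ∀ {A B : Set} → FinLinOrder A → FinLinOrder B → FinLinOrder (A × B)
FinLinOrder-× (m , A↔m) (n , B↔n) = m * n , ↔-trans (×-cong A↔m B↔n) (↔-sym *↔×)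

-- Prefix F k = F 0 × … × F (k - 1), defined by shifting the family so that
-- take and pad below are structural.
Prefix : (ℕ → Set) → ℕ → Set
Prefix F zero    = ⊤
Prefix F (suc k) = F 0 × Prefix (λ n → F (suc n)) k

Prefix-finLinOrder : ∀ {F} → (∀ n → FinLinOrder (F n)) → ∀ k → FinLinOrder (Prefix F k)
Prefix-finLinOrder     fin zero    = FinLinOrder-⊤
Prefix-finLinOrder {F} fin (suc k) =
  FinLinOrder-× (fin 0) (Prefix-finLinOrder {λ n → F (suc n)} (λ n → fin (suc n)) k)

take : ∀ {F} → ((n : ℕ) → F n) → ∀ k → Prefix F k
take     α zero    = tt
take {F} α (suc k) = α 0 , take {λ n → F (suc n)} (λ n → α (suc n)) k

pad : ∀ {F} → ((n : ℕ) → F n) → ∀ k → Prefix F k → (n : ℕ) → F n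
pad     pt zero    _       n       = pt n
pad     pt (suc k) (a , _) zero    = a
pad {F} pt (suc k) (_ , t) (suc n) = pad {λ n → F (suc n)} (λ n → pt (suc n)) k t n

pad-take : ∀ {F} (pt α : (n : ℕ) → F n) k → α ∼[ k ] pad pt k (take α k)
pad-take     pt α (suc k) zero    _         = refl
pad-take {F} pt α (suc k) (suc i) (s≤s i<k) =
  pad-take {λ n → F (suc n)} (λ n → pt (suc n)) (λ n → α (suc n)) k i i<k

discSeqC-totallyBounded : ∀ {F} → (∀ n → FinLinOrder (F n)) → ((n : ℕ) → F n)
  → (d : ∀ n (a b : F n) → Dec (a ≡ b)) → TotallyBounded (discSeqC d)
discSeqC-totallyBounded {F} fin pt d ε = record
  { X'     = Prefix F ε
  ; X'-fin = Prefix-finLinOrder fin ε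
  ; g      = pad pt ε
  ; h      = λ α → take α ε
  ; approx = λ α → ∼⇒C d ε (pad-take pt α ε)
  }

lemma3p71 : (F : ℕ → Set) → (fin : (n : ℕ) → FinLinOrder (F n)) → (pt : (n : ℕ) → F n)
    → IsClosenessSpace (_≐_ {F}) (discSeqC (λ n → finDecEq (fin n)))
      × TotallyBounded (discSeqC (λ n → finDecEq (fin n)))
lemma3p71 F fin pt =
  discSeqC-isClosenessSpace d , discSeqC-totallyBounded fin pt d
  where
  d : ∀ n (a b : F n) → Dec (a ≡ b)
  d n = finDecEq (fin n)
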